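{- Fix an integer $n\geq 2$. Then $\varepsilon_1(n,l)\sim n^{3l/2}$ as $l\to\infty$ through even integers, i.e. $\varepsilon_1(n,l)/n^{3l/2}\to 1$.
   Context: A nonempty word $u$ is primitive if $u=v^m$ with $m$ a positive integer implies $m=1$; $|u|$ is its length. For an alphabet $\mathcal{A}$ of size $n$, $\varepsilon_1(n,l)$ is the number of pairs $(p,q)$ of primitive words over $\mathcal{A}$ with $|p|=2|q|=2l$, $pq$ not primitive, and $p=xqx$ for some nonempty word $x$ with $xq$ primitive and $|q|=2|x|$. -}

module Defs where

open import Data.Nat using (ℕ; zero; suc; _+_; _*_; _^_; _≤_; _<_; ∣_-_∣)
open import Data.Fin using (Fin)
open import Data.List using (List; []; _++_; length; concat; replicate)
open import Data.List.Membership.Propositional using (_∈_)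
open import Data.List.Relation.Unary.Unique.Propositional using (Unique)
open import Data.Product using (Σ; ∃; _×_; _,_)
open import Relation.Binary.PropositionalEquality using (_≡_; _≢_)
open import Relation.Nullary using (¬_)
open import Function.Bundles using (_⇔_)

Word : ℕ → Set
Word n = List (Fin n)

_^ʷ_ : ∀ {n} → Word n → ℕ → Word n
v ^ʷ m = concat (replicate m v)

Primitive : ∀ {n} → Word n → Set
Primitive {n} u = (u ≢ []) × (∀ (v : Word n) (m : ℕ) → 0 < m → u ≡ v ^ʷ m → m ≡ 1)

E1Cond : (n l : ℕ) → Word n × Word n → Set
E1Cond n l (p , q) =
  Primitive p × Primitive q
  × length p ≡ 2 * l × 2 * length q ≡ 2 * l
  × ¬ Primitive (p ++ q)
  × ∃ λ (x : Word n) → (x ≢ []) × (p ≡ x ++ q ++ x) × Primitive (x ++ q)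
                       × (length q ≡ 2 * length x)

-- "ε₁(n,l) = k": there is a duplicate-free list enumerating exactly the pairs
-- (p,q) satisfying E1Cond, and it has length k.
ε₁≡ : (n l k : ℕ) → Set
ε₁≡ n l k = ∃ λ (xs : List (Word n × Word n)) →
  Unique xs × length xs ≡ k × (∀ pq → (pq ∈ xs) ⇔ E1Cond n l pq)

-- A counted pair is (x q x , q) with |x| = m, |q| = 2m and q, x q, x q x primitive; the
-- condition that p q be imprimitive is automatic, since p q = (x q)². Gluing (p , q) to
-- x q is therefore injective, so ε₁(n, 2m) ≤ n^{3m}. Conversely a word x q of length 3m is
-- missed only when q, x q or x q x is a proper power. A proper power of length L is
-- determined by a root of length at most L/2, so there are at most (L/2 + 1) n^{L/2} of
-- them, and n^{3m} − ε₁(n, 2m) ≤ (5m + 3) n^{2m}, which is o(n^{3m}).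
module Submission where

open import Defs
open import Data.Empty using (⊥-elim)
open import Data.Fin using (Fin)
open import Data.Fin.Properties using () renaming (_≟_ to _≟ᶠ_)
open import Data.List
  using (List; []; _∷_; [_]; _++_; length; map; take; drop; filter; allFin; cartesianProduct; cartesianProductWith)
open import Data.List.Membership.Propositional using (_∈_; _─_)
open import Data.List.Membership.Propositional.Properties
  using ( ∈-allFin; ∈-map⁺; ∈-++⁺ˡ; ∈-++⁺ʳ; ∈-cartesianProductWith⁺; ∈-cartesianProductWith⁻
        ; ∈-cartesianProduct⁺; ∈-filter⁺; ∈-filter⁻)
open import Data.List.Properties
  using ( length-++; length-map; length-take; length-drop; length-tabulate; length-removeAt′
        ; ++-assoc; ++-identityʳ; take++drop≡id; ≡-dec; ∷-injective)
open import Data.List.Relation.Unary.All as All using ([])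
open import Data.List.Relation.Unary.AllPairs using ([]; _∷_)
open import Data.List.Relation.Unary.Any using (here; there; index)
open import Data.List.Relation.Unary.Unique.Propositional using (Unique)
open import Data.List.Relation.Unary.Unique.Propositional.Properties
  using (cartesianProductWith⁺; cartesianProduct⁺; allFin⁺; filter⁺)
open import Data.Nat
  using (ℕ; zero; suc; _+_; _*_; _^_; _≤_; _<_; _≥_; _∸_; ∣_-_∣; z≤n; s≤s; _⊓_; NonZero; >-nonZero)
open import Data.Nat.Properties
open import Data.Nat.Tactic.RingSolver using (solve-∀)
open import Data.Product using (∃; ∃₂; _×_; _,_; proj₂)
open import Function.Base using (_∘_; id)
open import Data.Sum using (_⊎_; inj₁; inj₂)
open import Function.Bundles using (mk⇔; Equivalence)
open import Relation.Nullary using (¬_; Dec; yes; no)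
open import Relation.Nullary.Decidable using (map′; _×-dec_; ¬?; from-yes)
open import Relation.Unary using (Decidable)
open import Relation.Binary.PropositionalEquality
  using (_≡_; _≢_; refl; sym; trans; cong; cong₂; subst; module ≡-Reasoning)

private
  variable
    A B C : Set
    n : ℕ

take-length-++ : (xs ys : List A) → take (length xs) (xs ++ ys) ≡ xs
take-length-++ []       ys = refl
take-length-++ (x ∷ xs) ys = cong (x ∷_) (take-length-++ xs ys)

++-injective : (ws xs : List A) {ys zs : List A} →
               length ws ≡ length xs → ws ++ ys ≡ xs ++ zs → ws ≡ xs × ys ≡ zs
++-injective []       []       _     eq = refl , eq
++-injective (w ∷ ws) (x ∷ xs) |ws|≡|xs| eq with refl , eq′ ← ∷-injective eq =
  let ws≡xs , ys≡zs = ++-injective ws xs (suc-injective |ws|≡|xs|) eq′ in cong (w ∷_) ws≡xs , ys≡zs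

length-++-≡ : ∀ {a b} (xs ys : List A) → length xs ≡ a → length ys ≡ b → length (xs ++ ys) ≡ a + b
length-++-≡ xs ys |xs|≡a |ys|≡b = trans (length-++ xs) (cong₂ _+_ |xs|≡a |ys|≡b)

length-cartesianProductWith : (f : A → B → C) (xs : List A) (ys : List B) →
  length (cartesianProductWith f xs ys) ≡ length xs * length ys
length-cartesianProductWith f []       ys = refl
length-cartesianProductWith f (x ∷ xs) ys = trans (length-++ (map (f x) ys))
  (cong₂ _+_ (length-map (f x) ys) (length-cartesianProductWith f xs ys))

∃-prefix? : {P : List A → Set} → Decidable P → (p : List A) →
            (∀ {x} → P x → take (length x) p ≡ x) → Dec (∃ P)
∃-prefix? {P = P} P? p prefix = map′
  (λ (d , _ , Ptake) → take d p , Ptake)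
  (λ (x , Px) → length x , s≤s (|x|≤|p| (prefix Px)) , subst P (sym (prefix Px)) Px)
  (anyUpTo? (λ d → P? (take d p)) (suc (length p)))
  where
  |x|≤|p| : ∀ {x} → take (length x) p ≡ x → length x ≤ length p
  |x|≤|p| {x} eq = subst (_≤ length p) (trans (sym (length-take (length x) p)) (cong length eq))
                     (m⊓n≤n (length x) (length p))

∈-─ : ∀ {x y} {ys : List B} (y∈ys : y ∈ ys) → x ∈ ys → x ≢ y → x ∈ ys ─ y∈ys
∈-─ (here refl) (here refl) x≢y = ⊥-elim (x≢y refl)
∈-─ (here refl) (there x∈ys) _ = x∈ys
∈-─ (there y∈ys) (here refl) _ = here refl
∈-─ (there y∈ys) (there x∈ys) x≢y = there (∈-─ y∈ys x∈ys x≢y)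

length-≤-injectiveOn : (f : A → B) {xs : List A} {ys : List B} → Unique xs →
  (∀ {x y} → x ∈ xs → y ∈ xs → f x ≡ f y → x ≡ y) →
  (∀ {x} → x ∈ xs → f x ∈ ys) → length xs ≤ length ys
length-≤-injectiveOn f {[]}     _             _   _    = z≤n
length-≤-injectiveOn f {x ∷ xs} {ys} (x∉xs ∷ xs!) inj into = begin
  suc (length xs)         ≤⟨ s≤s (length-≤-injectiveOn f xs! (λ u v → inj (there u) (there v)) into′) ⟩
  suc (length (ys ─ fx∈)) ≡⟨ length-removeAt′ ys (index fx∈) ⟨
  length ys               ∎
  where
  open ≤-Reasoning
  fx∈ = into (here refl)
  into′ : ∀ {y} → y ∈ xs → f y ∈ ys ─ fx∈
  into′ y∈xs = ∈-─ fx∈ (into (there y∈xs))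
    (λ fy≡fx → All.lookup x∉xs y∈xs (sym (inj (there y∈xs) (here refl) fy≡fx)))

length-^ʷ : (v : Word n) (r : ℕ) → length (v ^ʷ r) ≡ r * length v
length-^ʷ v zero    = refl
length-^ʷ v (suc r) = trans (length-++ v) (cong (length v +_) (length-^ʷ v r))

^ʷ-+ : (v : Word n) (r s : ℕ) → v ^ʷ (r + s) ≡ v ^ʷ r ++ v ^ʷ s
^ʷ-+ v zero    s = refl
^ʷ-+ v (suc r) s = trans (cong (v ++_) (^ʷ-+ v r s)) (sym (++-assoc v (v ^ʷ r) (v ^ʷ s)))

[]-^ʷ : (r : ℕ) → [] ^ʷ r ≡ ([] {A = Fin n})
[]-^ʷ zero    = refl
[]-^ʷ (suc r) = []-^ʷ r

take-^ʷ : (v : Word n) {r s : ℕ} → r ≤ s → take (length (v ^ʷ r)) (v ^ʷ s) ≡ v ^ʷ r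
take-^ʷ v {r} {s} r≤s = begin
  take |vʳ| (v ^ʷ s)                  ≡⟨ cong (λ t → take |vʳ| (v ^ʷ t)) (m+[n∸m]≡n r≤s) ⟨
  take |vʳ| (v ^ʷ (r + (s ∸ r)))      ≡⟨ cong (take |vʳ|) (^ʷ-+ v r (s ∸ r)) ⟩
  take |vʳ| (v ^ʷ r ++ v ^ʷ (s ∸ r))  ≡⟨ take-length-++ (v ^ʷ r) (v ^ʷ (s ∸ r)) ⟩
  v ^ʷ r                              ∎
  where
  open ≡-Reasoning
  |vʳ| = length (v ^ʷ r)

-- Powers and primitive words

IsProperPower : Word n → Set
IsProperPower u = ∃₂ λ v r → u ≡ v ^ʷ (2 + r)

Primitive⇒¬IsProperPower : {u : Word n} → Primitive u → ¬ IsProperPower u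
Primitive⇒¬IsProperPower (_ , prim) (v , r , u≡v²⁺ʳ) with () ← prim v (2 + r) (s≤s z≤n) u≡v²⁺ʳ

¬IsProperPower⇒Primitive : {u : Word n} → u ≢ [] → ¬ IsProperPower u → Primitive u
¬IsProperPower⇒Primitive {u = u} u≢[] ¬pow = u≢[] , exponent≡1
  where
  exponent≡1 : ∀ v m → 0 < m → u ≡ v ^ʷ m → m ≡ 1
  exponent≡1 v (suc zero)    _ _    = refl
  exponent≡1 v (suc (suc r)) _ u≡vᵐ = ⊥-elim (¬pow (v , r , u≡vᵐ))

¬Primitive-++-self : (u : Word n) → ¬ Primitive (u ++ u)
¬Primitive-++-self u (_ , prim) with () ← prim u 2 (s≤s z≤n) (cong (u ++_) (sym (++-identityʳ u)))

_≟ʷ_ : (u v : Word n) → Dec (u ≡ v)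
_≟ʷ_ = ≡-dec _≟ᶠ_

-- For a nonempty root the exponent is bounded by the length of the power.
isPowerOf? : (u v : Word n) → Dec (∃ λ r → u ≡ v ^ʷ (2 + r))
isPowerOf? u [] = map′ (λ { refl → 0 , refl }) (λ (r , u≡[]) → trans u≡[] ([]-^ʷ (2 + r))) (u ≟ʷ [])
isPowerOf? u v@(_ ∷ _) = map′
  (λ (r , _ , eq) → r , eq)
  (λ (r , eq) → r , r<|u| r eq , eq)
  (anyUpTo? (λ r → u ≟ʷ (v ^ʷ (2 + r))) (length u))
  where
  r<|u| : ∀ r → u ≡ v ^ʷ (2 + r) → r < length u
  r<|u| r eq = begin-strict
    r                  <⟨ m<n+m r (s≤s z≤n) ⟩
    2 + r              ≤⟨ m≤m*n (2 + r) (length v) ⟩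
    (2 + r) * length v ≡⟨ trans (cong length eq) (length-^ʷ v (2 + r)) ⟨
    length u           ∎
    where open ≤-Reasoning

isProperPower? : (u : Word n) → Dec (IsProperPower u)
isProperPower? u = ∃-prefix? (isPowerOf? u) u
  λ {v} (r , eq) → trans (cong (take (length v)) eq) (take-length-++ v (v ^ʷ (1 + r)))

primitive? : (u : Word n) → Dec (Primitive u)
primitive? []        = no λ (u≢[] , _) → u≢[] refl
primitive? u@(_ ∷ _) with isProperPower? u
... | yes pow  = no λ prim → Primitive⇒¬IsProperPower prim pow
... | no ¬pow  = yes (¬IsProperPower⇒Primitive (λ ()) ¬pow)

¬Primitive⇒IsProperPower : {u : Word n} → ¬ Primitive u → IsProperPower u
¬Primitive⇒IsProperPower {u = []}    _     = [] , 0 , refl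
¬Primitive⇒IsProperPower {u = u@(_ ∷ _)} ¬prim with isProperPower? u
... | yes pow = pow
... | no ¬pow = ⊥-elim (¬prim (¬IsProperPower⇒Primitive (λ ()) ¬pow))

words : ℕ → List (Word n)
words         zero    = [ [] ]
words {n = n} (suc L) = cartesianProductWith _∷_ (allFin n) (words L)

length-words : ∀ L → length (words {n} L) ≡ n ^ L
length-words         zero    = refl
length-words {n = n} (suc L) = trans (length-cartesianProductWith _∷_ (allFin n) (words L))
  (cong₂ _*_ (length-tabulate {n = n} (λ i → i)) (length-words L))

words-unique : ∀ L → Unique (words {n} L)
words-unique         zero    = [] ∷ []
words-unique {n = n} (suc L) = cartesianProductWith⁺ _∷_ ∷-injective (allFin⁺ n) (words-unique L)

∈-words⁺ : ∀ {L} {w : Word n} → length w ≡ L → w ∈ words L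
∈-words⁺ {w = []}    refl = here refl
∈-words⁺ {w = a ∷ w} refl = ∈-cartesianProductWith⁺ _∷_ (∈-allFin a) (∈-words⁺ refl)

∈-words⁻ : ∀ L {w : Word n} → w ∈ words L → length w ≡ L
∈-words⁻         zero    (here refl) = refl
∈-words⁻ {n = n} (suc L) w∈ with _ , _ , _ , v∈ , refl ← ∈-cartesianProductWith⁻ _∷_ (allFin n) (words L) w∈ =
  cong suc (∈-words⁻ L v∈)

-- The length-L prefix of v v v …; L copies of v suffice when v is nonempty.
cycleTo : ℕ → Word n → Word n
cycleTo L v = take L (v ^ʷ L)

cycleTo-^ʷ : (v : Word n) (r : ℕ) → cycleTo (length (v ^ʷ r)) v ≡ v ^ʷ r
cycleTo-^ʷ []        r = trans (cong (λ w → cycleTo (length w) []) ([]-^ʷ r)) (sym ([]-^ʷ r))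
cycleTo-^ʷ v@(_ ∷ _) r = take-^ʷ v (subst (r ≤_) (sym (length-^ʷ v r)) (m≤m*n r (length v)))

-- A superset of the proper powers of length L with a root of length at most h.
properPowers : ℕ → ℕ → List (Word n)
properPowers L zero    = map (cycleTo L) (words 0)
properPowers L (suc h) = map (cycleTo L) (words (suc h)) ++ properPowers L h

length-properPowers : .{{NonZero n}} → ∀ L h → length (properPowers {n} L h) ≤ suc h * n ^ h
length-properPowers {n = n} L zero = ≤-reflexive (length-map (cycleTo L) (words {n} 0))
length-properPowers {n = n} L (suc h) = begin
  length (layer ++ properPowers L h)      ≡⟨ length-++ layer ⟩
  length layer + length (properPowers L h)
    ≤⟨ +-mono-≤ (≤-reflexive (trans (length-map (cycleTo {n} L) (words (suc h))) (length-words {n} (suc h))))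
                (length-properPowers L h) ⟩
  n ^ suc h + suc h * n ^ h
    ≤⟨ +-monoʳ-≤ (n ^ suc h) (*-monoʳ-≤ (suc h) (^-monoʳ-≤ n (n≤1+n h))) ⟩
  n ^ suc h + suc h * n ^ suc h           ∎
  where
  open ≤-Reasoning
  layer = map (cycleTo {n} L) (words (suc h))

properPowers-⊇ : ∀ L {d h} {u : Word n} → d ≤ h → u ∈ map (cycleTo L) (words d) → u ∈ properPowers L h
properPowers-⊇ L {h = zero}  z≤n u∈ = u∈
properPowers-⊇ L {h = suc h} d≤1+h u∈ with m≤n⇒m<n∨m≡n d≤1+h
... | inj₁ (s≤s d≤h) = ∈-++⁺ʳ _ (properPowers-⊇ L d≤h u∈)
... | inj₂ refl      = ∈-++⁺ˡ u∈

∈-properPowers : ∀ h {L} {u : Word n} → IsProperPower u → length u ≡ L → L ≤ 2 * h → u ∈ properPowers L h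
∈-properPowers h {u = u} (v , r , refl) refl |u|≤2h = properPowers-⊇ (length u) |v|≤h
  (subst (_∈ map (cycleTo (length u)) (words (length v))) (cycleTo-^ʷ v (2 + r))
    (∈-map⁺ (cycleTo (length u)) (∈-words⁺ refl)))
  where
  |v|≤h : length v ≤ h
  |v|≤h = *-cancelˡ-≤ 2 (begin
    2 * length v       ≤⟨ *-monoˡ-≤ (length v) (m≤m+n 2 r) ⟩
    (2 + r) * length v ≡⟨ length-^ʷ v (2 + r) ⟨
    length u           ≤⟨ |u|≤2h ⟩
    2 * h              ∎)
    where open ≤-Reasoning

-- Counting the pairs

E1Cond? : ∀ n l → Decidable (E1Cond n l)
E1Cond? n l (p , q) =
  primitive? p ×-dec primitive? q ×-dec length p ≟ 2 * l ×-dec 2 * length q ≟ 2 * l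
  ×-dec ¬? (primitive? (p ++ q)) ×-dec ∃-prefix? middle? p prefix
  where
  middle? : ∀ x → Dec (x ≢ [] × p ≡ x ++ q ++ x × Primitive (x ++ q) × length q ≡ 2 * length x)
  middle? x = ¬? (x ≟ʷ []) ×-dec p ≟ʷ (x ++ q ++ x) ×-dec primitive? (x ++ q) ×-dec length q ≟ 2 * length x
  prefix : ∀ {x} → x ≢ [] × p ≡ x ++ q ++ x × Primitive (x ++ q) × length q ≡ 2 * length x →
           take (length x) p ≡ x
  prefix {x} (_ , p≡xqx , _) = trans (cong (take (length x)) p≡xqx) (take-length-++ x (q ++ x))

ε₁-exists : ∀ n l → ∃ (ε₁≡ n l)
ε₁-exists n l = length pairs , pairs , filter⁺ (E1Cond? n l) candidates-unique , refl , λ pq →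
  mk⇔ (λ pq∈ → proj₂ (∈-filter⁻ (E1Cond? n l) {xs = candidates} pq∈))
      (λ c → ∈-filter⁺ (E1Cond? n l) (candidate c) c)
  where
  candidates = cartesianProduct (words {n} (2 * l)) (words l)
  pairs = filter (E1Cond? n l) candidates
  candidates-unique : Unique candidates
  candidates-unique = cartesianProduct⁺ (words-unique (2 * l)) (words-unique l)
  candidate : ∀ {pq} → E1Cond n l pq → pq ∈ candidates
  candidate (_ , _ , |p|≡2l , 2|q|≡2l , _) =
    ∈-cartesianProduct⁺ (∈-words⁺ |p|≡2l) (∈-words⁺ (*-cancelˡ-≡ _ l 2 2|q|≡2l))

length-x++q++x : ∀ {m} (x q : Word n) → length x ≡ m → length q ≡ 2 * m → length (x ++ q ++ x) ≡ 2 * (2 * m)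
length-x++q++x {m = m} x q |x|≡m |q|≡2m =
  trans (length-++-≡ x (q ++ x) |x|≡m (length-++-≡ q x |q|≡2m |x|≡m)) (m+[2m+m]≡2[2m] m)
  where
  m+[2m+m]≡2[2m] : ∀ m → m + (2 * m + m) ≡ 2 * (2 * m)
  m+[2m+m]≡2[2m] = solve-∀

E1Cond⇒shape : ∀ {m} {p q : Word n} → E1Cond n (2 * m) (p , q) →
  ∃ λ x → length x ≡ m × length q ≡ 2 * m × p ≡ x ++ q ++ x
E1Cond⇒shape {m = m} {q = q} (_ , _ , _ , 2|q|≡2[2m] , _ , x , _ , p≡xqx , _ , |q|≡2|x|) =
  x , *-cancelˡ-≡ (length x) m 2 (trans (sym |q|≡2|x|) |q|≡2m) , |q|≡2m , p≡xqx
  where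
  |q|≡2m : length q ≡ 2 * m
  |q|≡2m = *-cancelˡ-≡ (length q) (2 * m) 2 2|q|≡2[2m]

E1Cond-intro : ∀ {m} (x q : Word n) → 1 ≤ m → length x ≡ m → length q ≡ 2 * m →
  Primitive q → Primitive (x ++ q) → Primitive (x ++ q ++ x) → E1Cond n (2 * m) (x ++ q ++ x , q)
E1Cond-intro x q 1≤m |x|≡m |q|≡2m q-prim xq-prim xqx-prim =
  xqx-prim , q-prim , length-x++q++x x q |x|≡m |q|≡2m , cong (2 *_) |q|≡2m ,
  subst (¬_ ∘ Primitive) (sym square) (¬Primitive-++-self (x ++ q)) ,
  x , x≢[] , refl , xq-prim , trans |q|≡2m (cong (2 *_) (sym |x|≡m))
  where
  x≢[] : x ≢ []
  x≢[] refl = <⇒≢ 1≤m |x|≡m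
  square : (x ++ q ++ x) ++ q ≡ (x ++ q) ++ (x ++ q)
  square = begin
    (x ++ q ++ x) ++ q   ≡⟨ ++-assoc x (q ++ x) q ⟩
    x ++ (q ++ x) ++ q   ≡⟨ cong (x ++_) (++-assoc q x q) ⟩
    x ++ q ++ x ++ q     ≡⟨ ++-assoc x q (x ++ q) ⟨
    (x ++ q) ++ x ++ q   ∎
    where open ≡-Reasoning

glue : ℕ → Word n × Word n → Word n
glue m (p , q) = take m p ++ q

glue-x++q++x : ∀ {m} (x q : Word n) → length x ≡ m → glue m (x ++ q ++ x , q) ≡ x ++ q
glue-x++q++x x q refl = cong (_++ q) (take-length-++ x (q ++ x))

ε₁-upper : ∀ {m k} → ε₁≡ n (2 * m) k → k ≤ n ^ (3 * m)
ε₁-upper {n = n} {m} (xs , xs! , refl , ∈xs⇔) =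
  subst (length xs ≤_) (length-words (3 * m)) (length-≤-injectiveOn (glue m) xs! injective into)
  where
  shape : ∀ {p q} → (p , q) ∈ xs → ∃ λ x → length x ≡ m × length q ≡ 2 * m × p ≡ x ++ q ++ x
  shape {p} {q} pq∈ = E1Cond⇒shape (Equivalence.to (∈xs⇔ (p , q)) pq∈)
  injective : ∀ {pq pq′} → pq ∈ xs → pq′ ∈ xs → glue m pq ≡ glue m pq′ → pq ≡ pq′
  injective {p , q} {p′ , q′} pq∈ pq′∈ eq
    with x , |x|≡m , _ , refl ← shape pq∈ | x′ , |x′|≡m , _ , refl ← shape pq′∈
    with refl , refl ← ++-injective x x′ {q} {q′} (trans |x|≡m (sym |x′|≡m))
                         (trans (sym (glue-x++q++x x q |x|≡m)) (trans eq (glue-x++q++x x′ q′ |x′|≡m))) = refl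
  into : ∀ {pq} → pq ∈ xs → glue m pq ∈ words (3 * m)
  into {p , q} pq∈ with x , |x|≡m , |q|≡2m , refl ← shape pq∈ =
    subst (_∈ words (3 * m)) (sym (glue-x++q++x x q |x|≡m)) (∈-words⁺ (length-++-≡ x q |x|≡m |q|≡2m))

suffixPowers : ℕ → List (Word n)
suffixPowers m = cartesianProductWith _++_ (words m) (properPowers (2 * m) m)

-- Catches x q through its length-3m prefix when x q x is a proper power.
truncatedPowers : ℕ → List (Word n)
truncatedPowers m = map (take (3 * m)) (properPowers (2 * (2 * m)) (2 * m))

imprimitiveCover : ℕ → List (Word n)
imprimitiveCover m = suffixPowers m ++ properPowers (3 * m) (2 * m) ++ truncatedPowers m

∈-imprimitiveCover : ∀ {m} (x q : Word n) → length x ≡ m → length q ≡ 2 * m →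
  ¬ Primitive q ⊎ ¬ Primitive (x ++ q) ⊎ ¬ Primitive (x ++ q ++ x) → x ++ q ∈ imprimitiveCover m
∈-imprimitiveCover {m = m} x q |x|≡m |q|≡2m (inj₁ ¬q-prim) = ∈-++⁺ˡ
  (∈-cartesianProductWith⁺ _++_ (∈-words⁺ |x|≡m)
    (∈-properPowers m (¬Primitive⇒IsProperPower ¬q-prim) |q|≡2m ≤-refl))
∈-imprimitiveCover {m = m} x q |x|≡m |q|≡2m (inj₂ (inj₁ ¬xq-prim)) = ∈-++⁺ʳ (suffixPowers m) (∈-++⁺ˡ
  (∈-properPowers (2 * m) (¬Primitive⇒IsProperPower ¬xq-prim) (length-++-≡ x q |x|≡m |q|≡2m)
    (≤-trans (*-monoˡ-≤ m {3} {4} (n≤1+n 3)) (≤-reflexive (*-assoc 2 2 m)))))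
∈-imprimitiveCover {m = m} x q |x|≡m |q|≡2m (inj₂ (inj₂ ¬xqx-prim)) =
  ∈-++⁺ʳ (suffixPowers m) (∈-++⁺ʳ (properPowers (3 * m) (2 * m))
  (subst (_∈ truncatedPowers m) take-3m
    (∈-map⁺ (take (3 * m))
      (∈-properPowers (2 * m) (¬Primitive⇒IsProperPower ¬xqx-prim) (length-x++q++x x q |x|≡m |q|≡2m) ≤-refl))))
  where
  take-3m : take (3 * m) (x ++ q ++ x) ≡ x ++ q
  take-3m = begin
    take (3 * m) (x ++ q ++ x)                  ≡⟨ cong (take (3 * m)) (++-assoc x q x) ⟨
    take (3 * m) ((x ++ q) ++ x)
      ≡⟨ cong (λ L → take L ((x ++ q) ++ x)) (length-++-≡ x q |x|≡m |q|≡2m) ⟨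
    take (length (x ++ q)) ((x ++ q) ++ x)      ≡⟨ take-length-++ (x ++ q) x ⟩
    x ++ q                                      ∎
    where open ≡-Reasoning

length-suffixPowers : .{{NonZero n}} → ∀ m → length (suffixPowers {n} m) ≤ suc m * n ^ (2 * m)
length-suffixPowers {n = n} m = begin
  length (suffixPowers m)                     ≡⟨ length-cartesianProductWith _++_ (words m) (properPowers (2 * m) m) ⟩
  length (words m) * length (properPowers (2 * m) m)
                                              ≡⟨ cong (_* length (properPowers {n} (2 * m) m)) (length-words m) ⟩
  n ^ m * length (properPowers (2 * m) m)     ≤⟨ *-monoʳ-≤ (n ^ m) (length-properPowers (2 * m) m) ⟩
  n ^ m * (suc m * n ^ m)                     ≡⟨ swap (suc m) (n ^ m) ⟩
  suc m * (n ^ m * n ^ m)                     ≡⟨ cong (suc m *_) (^-distribˡ-+-* n m m) ⟨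
  suc m * n ^ (m + m)                         ≡⟨ cong (λ k → suc m * n ^ (m + k)) (+-identityʳ m) ⟨
  suc m * n ^ (2 * m)                         ∎
  where
  open ≤-Reasoning
  swap : ∀ s N → N * (s * N) ≡ s * (N * N)
  swap = solve-∀

length-truncatedPowers : .{{NonZero n}} → ∀ m → length (truncatedPowers {n} m) ≤ suc (2 * m) * n ^ (2 * m)
length-truncatedPowers {n = n} m = ≤-trans (≤-reflexive (length-map (take (3 * m)) (properPowers {n} (2 * (2 * m)) (2 * m))))
  (length-properPowers (2 * (2 * m)) (2 * m))

length-imprimitiveCover : .{{NonZero n}} → ∀ m → length (imprimitiveCover {n} m) ≤ (5 * m + 3) * n ^ (2 * m)
length-imprimitiveCover {n = n} m = begin
  length (suffixPowers m ++ properPowers (3 * m) (2 * m) ++ truncatedPowers m)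
    ≡⟨ trans (length-++ (suffixPowers m))
             (cong (length (suffixPowers {n} m) +_) (length-++ (properPowers (3 * m) (2 * m)))) ⟩
  length (suffixPowers m) + (length (properPowers (3 * m) (2 * m)) + length (truncatedPowers m))
    ≤⟨ +-mono-≤ (length-suffixPowers m) (+-mono-≤ (length-properPowers (3 * m) (2 * m)) (length-truncatedPowers m)) ⟩
  suc m * n ^ (2 * m) + (suc (2 * m) * n ^ (2 * m) + suc (2 * m) * n ^ (2 * m))
    ≡⟨ collect m (n ^ (2 * m)) ⟩
  (5 * m + 3) * n ^ (2 * m)
    ∎
  where
  open ≤-Reasoning
  collect : ∀ m N → suc m * N + (suc (2 * m) * N + suc (2 * m) * N) ≡ (5 * m + 3) * N
  collect = solve-∀

ε₁-lower : .{{NonZero n}} → ∀ {m k} → 1 ≤ m → ε₁≡ n (2 * m) k → n ^ (3 * m) ≤ k + (5 * m + 3) * n ^ (2 * m)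
ε₁-lower {n = n} {m} 1≤m (xs , xs! , refl , ∈xs⇔) = begin
  n ^ (3 * m)                                        ≡⟨ length-words (3 * m) ⟨
  length (words (3 * m))
    ≤⟨ length-≤-injectiveOn id (words-unique (3 * m)) (λ _ _ eq → eq) cover ⟩
  length (map (glue m) xs ++ imprimitiveCover m)
    ≡⟨ trans (length-++ (map (glue m) xs)) (cong (_+ length (imprimitiveCover {n} m)) (length-map (glue m) xs)) ⟩
  length xs + length (imprimitiveCover m)            ≤⟨ +-monoʳ-≤ (length xs) (length-imprimitiveCover m) ⟩
  length xs + (5 * m + 3) * n ^ (2 * m)              ∎
  where
  open ≤-Reasoning
  glued-or-imprimitive : ∀ (x q : Word n) → length x ≡ m → length q ≡ 2 * m →
                         x ++ q ∈ map (glue m) xs ++ imprimitiveCover m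
  glued-or-imprimitive x q |x|≡m |q|≡2m with primitive? q | primitive? (x ++ q) | primitive? (x ++ q ++ x)
  ... | yes q-prim | yes xq-prim | yes xqx-prim =
    ∈-++⁺ˡ (subst (_∈ map (glue m) xs) (glue-x++q++x x q |x|≡m)
      (∈-map⁺ (glue m) (Equivalence.from (∈xs⇔ _) (E1Cond-intro x q 1≤m |x|≡m |q|≡2m q-prim xq-prim xqx-prim))))
  ... | no ¬q-prim | _ | _ =
    ∈-++⁺ʳ (map (glue m) xs) (∈-imprimitiveCover x q |x|≡m |q|≡2m (inj₁ ¬q-prim))
  ... | yes _ | no ¬xq-prim | _ =
    ∈-++⁺ʳ (map (glue m) xs) (∈-imprimitiveCover x q |x|≡m |q|≡2m (inj₂ (inj₁ ¬xq-prim)))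
  ... | yes _ | yes _ | no ¬xqx-prim =
    ∈-++⁺ʳ (map (glue m) xs) (∈-imprimitiveCover x q |x|≡m |q|≡2m (inj₂ (inj₂ ¬xqx-prim)))
  cover : ∀ {w} → w ∈ words (3 * m) → w ∈ map (glue m) xs ++ imprimitiveCover m
  cover {w} w∈ = subst (_∈ map (glue m) xs ++ imprimitiveCover m) (take++drop≡id m w)
    (glued-or-imprimitive (take m w) (drop m w)
      (trans (length-take m w) (trans (cong (m ⊓_) |w|≡3m) (m≤n⇒m⊓n≡m (m≤m+n m (2 * m)))))
      (trans (length-drop m w) (trans (cong (_∸ m) |w|≡3m) (m+n∸m≡n m (2 * m)))))
    where
    |w|≡3m = ∈-words⁻ (3 * m) w∈

ε₁-deviation : .{{NonZero n}} → ∀ {m k} → 1 ≤ m → ε₁≡ n (2 * m) k →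
               ∣ k - n ^ (3 * m) ∣ ≤ (5 * m + 3) * n ^ (2 * m)
ε₁-deviation {n = n} {m} {k} 1≤m ε₁≡k = begin
  ∣ k - n ^ (3 * m) ∣  ≡⟨ m≤n⇒∣m-n∣≡n∸m (ε₁-upper {m = m} ε₁≡k) ⟩
  n ^ (3 * m) ∸ k      ≤⟨ m≤n+o⇒m∸n≤o (n ^ (3 * m)) k (ε₁-lower 1≤m ε₁≡k) ⟩
  (5 * m + 3) * n ^ (2 * m) ∎
  where open ≤-Reasoning

-- Growth

[5+t]²<2^[5+t] : ∀ t → (5 + t) * (5 + t) < 2 ^ (5 + t)
[5+t]²<2^[5+t] zero    = from-yes (25 <? 32)
[5+t]²<2^[5+t] (suc t) = begin-strict
  suc a * suc a         ≡⟨ expand a ⟩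
  a * a + (2 * a + 1)   ≤⟨ +-monoʳ-≤ (a * a) 2a+1≤a² ⟩
  a * a + a * a         <⟨ +-mono-< ([5+t]²<2^[5+t] t) ([5+t]²<2^[5+t] t) ⟩
  2 ^ a + 2 ^ a         ≡⟨ cong (2 ^ a +_) (+-identityʳ (2 ^ a)) ⟨
  2 ^ suc a             ∎
  where
  open ≤-Reasoning
  a = 5 + t
  expand : ∀ a → suc a * suc a ≡ a * a + (2 * a + 1)
  expand = solve-∀
  2a+1≤a² : 2 * a + 1 ≤ a * a
  2a+1≤a² = begin
    2 * a + 1      ≤⟨ +-monoʳ-≤ (2 * a) (s≤s z≤n) ⟩
    2 * a + 3 * a  ≡⟨ *-distribʳ-+ a 2 3 ⟨
    5 * a          ≤⟨ *-monoˡ-≤ a (m≤m+n 5 t) ⟩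
    a * a          ∎

m²<2^m : ∀ {m} → 5 ≤ m → m * m < 2 ^ m
m²<2^m 5≤m with t , refl ← m≤n⇒∃[o]m+o≡n 5≤m = [5+t]²<2^[5+t] t

c*[5m+3]<2^m : ∀ c m → 8 * c + 5 ≤ m → c * (5 * m + 3) < 2 ^ m
c*[5m+3]<2^m c m 8c+5≤m = begin-strict
  c * (5 * m + 3)   ≤⟨ *-monoʳ-≤ c (+-monoʳ-≤ (5 * m) (*-monoʳ-≤ 3 1≤m)) ⟩
  c * (5 * m + 3 * m) ≡⟨ cong (c *_) (*-distribʳ-+ m 5 3) ⟨
  c * (8 * m)       ≡⟨ *-assoc c 8 m ⟨
  c * 8 * m         ≤⟨ *-monoˡ-≤ m (≤-trans (≤-reflexive (*-comm c 8)) (≤-trans (m≤m+n (8 * c) 5) 8c+5≤m)) ⟩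
  m * m             <⟨ m²<2^m (≤-trans (m≤n+m 5 (8 * c)) 8c+5≤m) ⟩
  2 ^ m             ∎
  where
  open ≤-Reasoning
  1≤m : 1 ≤ m
  1≤m = ≤-trans (s≤s z≤n) (≤-trans (m≤n+m 5 (8 * c)) 8c+5≤m)

proposition4p2 : (n : ℕ) → n ≥ 2 →
    ((l : ℕ) → ∃ λ k → ε₁≡ n l k)
    × ((j : ℕ) → ∃ λ M → (m : ℕ) → m ≥ M → (k : ℕ) → ε₁≡ n (2 * m) k →
         suc j * ∣ k - n ^ (3 * m) ∣ < n ^ (3 * m))
proposition4p2 n n≥2 = ε₁-exists n , λ j → 8 * suc j + 5 , λ m m≥M k ε₁≡k →
  let instance
        n≢0 = >-nonZero (≤-trans (s≤s z≤n) n≥2)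
        n^2m≢0 = m^n≢0 n (2 * m)
      open ≤-Reasoning
  in begin-strict
  suc j * ∣ k - n ^ (3 * m) ∣
    ≤⟨ *-monoʳ-≤ (suc j) (ε₁-deviation (≤-trans (s≤s z≤n) m≥M) ε₁≡k) ⟩
  suc j * ((5 * m + 3) * n ^ (2 * m))
    ≡⟨ *-assoc (suc j) (5 * m + 3) (n ^ (2 * m)) ⟨
  suc j * (5 * m + 3) * n ^ (2 * m)
    <⟨ *-monoˡ-< (n ^ (2 * m)) (<-≤-trans (c*[5m+3]<2^m (suc j) m m≥M) (^-monoˡ-≤ m n≥2)) ⟩
  n ^ m * n ^ (2 * m)
    ≡⟨ ^-distribˡ-+-* n m (2 * m) ⟨
  n ^ (3 * m)
    ∎
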